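{- Let $p\in\{2,3,4,\dots\}\cup\{\infty\}$ and $n\ge1$. For $P,Q\in\mathcal{F}_n^p$ we have $P\le Q$ in $\mathbb{F}_n^p$ if and only if $\lambda(P)\le\lambda(Q)$ in the dominance order, i.e. writing $\lambda(P)=(\lambda_1,\dots,\lambda_k)$ and $\lambda(Q)=(\mu_1,\dots,\mu_\ell)$, for every $m\ge1$ we have $\sum_{i=1}^m\lambda_i\le\sum_{i=1}^m\mu_i$ (with parts of index beyond the number of parts taken to be $0$).
   Context: A Dyck path of semilength $n\ge 0$ is a lattice path from $(0,0)$ to $(2n,0)$ with steps $U=(1,1)$ and $D=(1,-1)$ that never goes below the $x$-axis; it is identified with its word over $\{U,D\}$. A path avoids a pattern $\alpha$ if $\alpha$ does not occur as a factor (block of consecutive steps). For an integer $p\ge 2$, $\mathcal{F}_n^p$ is the set of Dyck paths of semilength $n$ avoiding $DUU$ and $D^{p+1}$; $\mathcal{F}_n^\infty$ is the set of those avoiding $DUU$. These are ordered by the Stanley order: $P\le Q$ iff $P$ lies weakly below $Q$ when both are drawn in the plane; $\mathbb{F}_n^p=(\mathcal{F}_n^p,\le)$. Every $P\in\mathcal{F}_n^p$ can be written uniquely as $P=U^{n-k+1}D^{\lambda_k}UD^{\lambda_{k-1}}\cdots UD^{\lambda_1}$ with $k\ge1$ and $\lambda_1,\dots,\lambda_k\in[1,p]$ (any positive integers if $p=\infty$), and $\lambda(P):=(\lambda_1,\dots,\lambda_k)$; this is a bijection from $\mathcal{F}_n^p$ onto the compositions of $n$ with parts in $[1,p]$. 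-}

module Defs where

open import Data.Nat using (ℕ; zero; suc; _+_; _*_; _∸_; _≤_)
open import Data.Integer as ℤ using (ℤ; +_; -[1+_])
open import Data.List using (List; []; _∷_; _++_; length; replicate; take; reverse; concatMap)
open import Data.Nat.ListAction using (sum)
open import Data.List.Relation.Unary.All using (All)
open import Data.Product using (Σ; _×_; ∃; ∃-syntax)
open import Data.Empty using (⊥)
open import Relation.Binary.PropositionalEquality using (_≡_)
open import Relation.Nullary using (¬_)

-- Steps of a lattice path: U = (1,1), D = (1,-1)
data Step : Set where
  U D : Step

Word : Set
Word = List Step

stepVal : Step → ℤ
stepVal U = + 1
stepVal D = -[1+ 0 ]

height : Word → ℤ
height []       = + 0
height (s ∷ w)  = stepVal s ℤ.+ height w

heightAt : ℕ → Word → ℤ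
heightAt i w = height (take i w)

IsDyck : ℕ → Word → Set
IsDyck n w = (length w ≡ 2 * n) × ((i : ℕ) → + 0 ℤ.≤ heightAt i w) × (height w ≡ + 0)

Factor : Word → Word → Set
Factor α w = ∃[ xs ] ∃[ ys ] (w ≡ xs ++ α ++ ys)

Avoids : Word → Word → Set
Avoids w α = ¬ Factor α w

data Param : Set where
  fin : (p : ℕ) → 2 ≤ p → Param
  ∞   : Param

PartOK : Param → ℕ → Set
PartOK (fin p _) a = (1 ≤ a) × (a ≤ p)
PartOK ∞         a = 1 ≤ a

AvoidsDp : Param → Word → Set
AvoidsDp (fin p _) w = Avoids w (replicate (suc p) D)
AvoidsDp ∞         w = Data.Unit.⊤
  where import Data.Unit

InF : Param → ℕ → Word → Set
InF p n w = IsDyck n w × Avoids w (D ∷ U ∷ U ∷ []) × AvoidsDp p w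

_≤S_ : Word → Word → Set
P ≤S Q = (i : ℕ) → heightAt i P ℤ.≤ heightAt i Q

blocks : List ℕ → Word
blocks []       = []
blocks (a ∷ as) = replicate a D ++ concatMap (λ b → U ∷ replicate b D) as

decode : ℕ → List ℕ → Word
decode n λs = replicate (suc n ∸ length λs) U ++ blocks (reverse λs)

IsLambda : Param → ℕ → Word → List ℕ → Set
IsLambda p n P λs = (1 ≤ length λs) × All (PartOK p) λs × (P ≡ decode n λs)

-- dominance order on compositions (missing parts read as 0)
_⊴_ : List ℕ → List ℕ → Set
λs ⊴ μs = (m : ℕ) → 1 ≤ m → sum (take m λs) ≤ sum (take m μs)

{-# OPTIONS --safe #-}
-- Both paths have length 2n and n down steps, so P lies below Q exactly when every suffix
-- of P has at most as many D's as the suffix of Q of the same length, i.e. when the reversed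
-- paths compare that way on prefixes. Read backwards, P is D^λ₁ U D^λ₂ U ⋯ U D^λₖ U^(n+1-k),
-- whose m-th U sits at position Sₘ + m with Sₘ = λ₁ + ⋯ + λₘ; hence its first t steps contain
-- min over m of max(Sₘ, t - m) D's. This is monotone in the partial sums, and at
-- t = Sₘ₊₁ + m it equals Sₘ₊₁, which recovers the partial sums from the prefix counts.
module Submission where

open import Defs
open import Data.Nat using (ℕ; _≤_)
open import Data.List using (List)
open import Data.Product using (_×_)

open import Data.Nat using (zero; suc; pred; _+_; _*_; _∸_; _⊓_; _⊔_; z≤n; s≤s)
open import Data.Nat.Properties
open import Data.Nat.ListAction using (sum)
open import Data.Integer as ℤ using (_⊖_)
import Data.Integer.Properties as ℤ
open import Data.List using ([]; _∷_; _++_; length; replicate; take; reverse; concatMap)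
open import Data.List.Properties
  using (++-assoc; ++-identityʳ; take-[]; take-all; length-take; length-reverse; unfold-reverse;
         reverse-++; reverse-involutive; concatMap-++; concatMap-cong)
open import Data.Product using (_,_; ∃-syntax)
open import Data.Sum using (inj₁; inj₂)
open import Data.Empty using (⊥-elim)
open import Function using (_∘_)
open import Function.Bundles using (_⇔_; mk⇔; Equivalence)
open import Function.Related.Propositional using (module EquationalReasoning)
open import Relation.Binary.PropositionalEquality

private
  variable
    A B : Set

take-++ˡ : ∀ {i} (xs ys : List A) → i ≤ length xs → take i (xs ++ ys) ≡ take i xs
take-++ˡ {i = zero}  _        _  _         = refl
take-++ˡ {i = suc i} (x ∷ xs) ys (s≤s i≤n) = cong (x ∷_) (take-++ˡ xs ys i≤n)

take-replicate-++ : ∀ a t (x : A) ys → take (a + t) (replicate a x ++ ys) ≡ replicate a x ++ take t ys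
take-replicate-++ zero    t x ys = refl
take-replicate-++ (suc a) t x ys = cong (x ∷_) (take-replicate-++ a t x ys)

replicate-∷ʳ : ∀ n (x : A) → replicate n x ++ x ∷ [] ≡ x ∷ replicate n x
replicate-∷ʳ zero    x = refl
replicate-∷ʳ (suc n) x = cong (x ∷_) (replicate-∷ʳ n x)

reverse-replicate : ∀ n (x : A) → reverse (replicate n x) ≡ replicate n x
reverse-replicate zero    x = refl
reverse-replicate (suc n) x = begin
  reverse (x ∷ replicate n x)        ≡⟨ unfold-reverse x (replicate n x) ⟩
  reverse (replicate n x) ++ x ∷ []  ≡⟨ cong (_++ x ∷ []) (reverse-replicate n x) ⟩
  replicate n x ++ x ∷ []            ≡⟨ replicate-∷ʳ n x ⟩
  x ∷ replicate n x                  ∎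
  where open ≡-Reasoning

reverse-concatMap : ∀ (f : A → List B) xs →
                    reverse (concatMap f xs) ≡ concatMap (reverse ∘ f) (reverse xs)
reverse-concatMap f []       = refl
reverse-concatMap f (x ∷ xs) = begin
  reverse (f x ++ concatMap f xs)                   ≡⟨ reverse-++ (f x) (concatMap f xs) ⟩
  reverse (concatMap f xs) ++ reverse (f x)         ≡⟨ cong₂ _++_ (reverse-concatMap f xs)
                                                                  (sym (++-identityʳ (g x))) ⟩
  concatMap g (reverse xs) ++ concatMap g (x ∷ [])  ≡⟨ concatMap-++ g (reverse xs) (x ∷ []) ⟨
  concatMap g (reverse xs ++ x ∷ [])                ≡⟨ cong (concatMap g) (unfold-reverse x xs) ⟨
  concatMap g (reverse (x ∷ xs))                    ∎
  where
  open ≡-Reasoning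
  g = reverse ∘ f

#D : Word → ℕ
#D []      = 0
#D (U ∷ w) = #D w
#D (D ∷ w) = suc (#D w)

prefix#D : Word → ℕ → ℕ
prefix#D w t = #D (take t w)

_≤ᴰ_ : Word → Word → Set
v ≤ᴰ w = ∀ t → prefix#D v t ≤ prefix#D w t

#D-++ : ∀ xs ys → #D (xs ++ ys) ≡ #D xs + #D ys
#D-++ []       ys = refl
#D-++ (U ∷ xs) ys = #D-++ xs ys
#D-++ (D ∷ xs) ys = cong suc (#D-++ xs ys)

#D-replicate-D : ∀ a → #D (replicate a D) ≡ a
#D-replicate-D zero    = refl
#D-replicate-D (suc a) = cong suc (#D-replicate-D a)

#D-replicate-U : ∀ c → #D (replicate c U) ≡ 0
#D-replicate-U zero    = refl
#D-replicate-U (suc c) = #D-replicate-U c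

#D-reverse : ∀ w → #D (reverse w) ≡ #D w
#D-reverse []      = refl
#D-reverse (x ∷ w) rewrite unfold-reverse x w | #D-++ (reverse w) (x ∷ []) | #D-reverse w with x
... | U = +-identityʳ (#D w)
... | D = +-comm (#D w) 1

prefix#D-≤ : ∀ w t → prefix#D w t ≤ t
prefix#D-≤ w       zero    = z≤n
prefix#D-≤ []      (suc t) = z≤n
prefix#D-≤ (U ∷ w) (suc t) = m≤n⇒m≤1+n (prefix#D-≤ w t)
prefix#D-≤ (D ∷ w) (suc t) = s≤s (prefix#D-≤ w t)

prefix#D-≤-#D : ∀ w t → prefix#D w t ≤ #D w
prefix#D-≤-#D w       zero    = z≤n
prefix#D-≤-#D []      (suc t) = z≤n
prefix#D-≤-#D (U ∷ w) (suc t) = prefix#D-≤-#D w t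
prefix#D-≤-#D (D ∷ w) (suc t) = s≤s (prefix#D-≤-#D w t)

prefix#D-++-#D≡0 : ∀ xs {ys} → #D ys ≡ 0 → ∀ t → prefix#D (xs ++ ys) t ≡ prefix#D xs t
prefix#D-++-#D≡0 []       {ys} noD t rewrite take-[] {A = Step} t =
  n≤0⇒n≡0 (subst (prefix#D ys t ≤_) noD (prefix#D-≤-#D ys t))
prefix#D-++-#D≡0 (x ∷ xs)      noD zero    = refl
prefix#D-++-#D≡0 (U ∷ xs)      noD (suc t) = prefix#D-++-#D≡0 xs noD t
prefix#D-++-#D≡0 (D ∷ xs)      noD (suc t) = cong suc (prefix#D-++-#D≡0 xs noD t)

prefix#D-replicate-D-++ : ∀ {t} a w → t ≤ a → prefix#D (replicate a D ++ w) t ≡ t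
prefix#D-replicate-D-++ {zero}  a       w _         = refl
prefix#D-replicate-D-++ {suc t} (suc a) w (s≤s t≤a) = cong suc (prefix#D-replicate-D-++ a w t≤a)

#D-take+#D-take-reverse : ∀ i w → #D (take i w) + #D (take (length w ∸ i) (reverse w)) ≡ #D w
#D-take+#D-take-reverse i []
  rewrite take-[] {A = Step} i | 0∸n≡0 i = refl
#D-take+#D-take-reverse zero w
  rewrite take-all (length w) (reverse w) (≤-reflexive (length-reverse w)) = #D-reverse w
#D-take+#D-take-reverse (suc i) (x ∷ w)
  rewrite unfold-reverse x w
        | take-++ˡ (reverse w) (x ∷ [])
                   (subst (length w ∸ i ≤_) (sym (length-reverse w)) (m∸n≤m (length w) i))
  with x
... | U = #D-take+#D-take-reverse i w
... | D = cong suc (#D-take+#D-take-reverse i w)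

#D-take-reverse+#D-take : ∀ j w → #D (take j (reverse w)) + #D (take (length w ∸ j) w) ≡ #D w
#D-take-reverse+#D-take j w = begin
  #D (take j (reverse w)) + #D (take (length w ∸ j) w)
    ≡⟨ cong₂ (λ ℓ u → #D (take j (reverse w)) + #D (take (ℓ ∸ j) u))
             (sym (length-reverse w)) (sym (reverse-involutive w)) ⟩
  #D (take j (reverse w)) + #D (take (length (reverse w) ∸ j) (reverse (reverse w)))
    ≡⟨ #D-take+#D-take-reverse j (reverse w) ⟩
  #D (reverse w)
    ≡⟨ #D-reverse w ⟩
  #D w
    ∎
  where open ≡-Reasoning

height≡length⊖2*#D : ∀ w → height w ≡ length w ⊖ 2 * #D w
height≡length⊖2*#D []      = refl
height≡length⊖2*#D (U ∷ w) = begin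
  stepVal U ℤ.+ height w               ≡⟨ cong (ℤ._+_ (stepVal U)) (height≡length⊖2*#D w) ⟩
  stepVal U ℤ.+ (length w ⊖ 2 * #D w)  ≡⟨ ℤ.distribʳ-⊖-+-pos 1 (length w) (2 * #D w) ⟩
  suc (length w) ⊖ 2 * #D w            ∎
  where open ≡-Reasoning
height≡length⊖2*#D (D ∷ w) = begin
  stepVal D ℤ.+ height w                ≡⟨ cong (ℤ._+_ (stepVal D)) (height≡length⊖2*#D w) ⟩
  stepVal D ℤ.+ (length w ⊖ 2 * #D w)   ≡⟨ ℤ.distribʳ-⊖-+-neg 0 (length w) (2 * #D w) ⟩
  length w ⊖ suc (2 * #D w)             ≡⟨ ℤ.[1+m]⊖[1+n]≡m⊖n (length w) (suc (2 * #D w)) ⟨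
  suc (length w) ⊖ (2 + 2 * #D w)       ≡⟨ cong (suc (length w) ⊖_) (*-suc 2 (#D w)) ⟨
  suc (length w) ⊖ 2 * suc (#D w)       ∎
  where open ≡-Reasoning

⊖-≤⇔≥ : ∀ ℓ {m n} → (ℓ ⊖ m ℤ.≤ ℓ ⊖ n) ⇔ (n ≤ m)
⊖-≤⇔≥ ℓ = mk⇔ (λ le → ≮⇒≥ (λ m<n → ℤ.<⇒≱ (ℤ.⊖-monoʳ->-< ℓ m<n) le)) (ℤ.⊖-monoʳ-≥-≤ ℓ)

height≤⇔#D≥ : ∀ {v w} → length v ≡ length w → (height v ℤ.≤ height w) ⇔ (#D w ≤ #D v)
height≤⇔#D≥ {v} {w} eq rewrite height≡length⊖2*#D v | height≡length⊖2*#D w | eq =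
  mk⇔ (*-cancelˡ-≤ 2 ∘ Equivalence.to (⊖-≤⇔≥ (length w)))
      (Equivalence.from (⊖-≤⇔≥ (length w)) ∘ *-monoʳ-≤ 2)

#D-cong : ∀ {v w} → length v ≡ length w → height v ≡ height w → #D v ≡ #D w
#D-cong {v} {w} eqL eqH =
  ≤-antisym (Equivalence.to (height≤⇔#D≥ {w} {v} (sym eqL)) (ℤ.≤-reflexive (sym eqH)))
            (Equivalence.to (height≤⇔#D≥ {v} {w} eqL) (ℤ.≤-reflexive eqH))

≤S⇔≥ᴰ : ∀ {P Q} → length P ≡ length Q → (P ≤S Q) ⇔ (Q ≤ᴰ P)
≤S⇔≥ᴰ {P} {Q} eq = mk⇔ (λ P≤Q i → Equivalence.to (prefixes i) (P≤Q i))
                        (λ Q≤P i → Equivalence.from (prefixes i) (Q≤P i))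
  where
  prefixes : ∀ i → (heightAt i P ℤ.≤ heightAt i Q) ⇔ (prefix#D Q i ≤ prefix#D P i)
  prefixes i = height≤⇔#D≥ {take i P} {take i Q}
    (trans (length-take i P) (trans (cong (i ⊓_) eq) (sym (length-take i Q))))

≤ᴰ-reverse : ∀ {v w} → length v ≡ length w → #D v ≡ #D w → v ≤ᴰ w → reverse w ≤ᴰ reverse v
≤ᴰ-reverse {v} {w} eqL eqD v≤w j = +-cancelʳ-≤ (prefix#D w i) _ _ (begin
  prefix#D (reverse w) j + prefix#D w i               ≡⟨ #D-take-reverse+#D-take j w ⟩
  #D w                                                ≡⟨ eqD ⟨
  #D v                                                ≡⟨ #D-take-reverse+#D-take j v ⟨
  prefix#D (reverse v) j + prefix#D v (length v ∸ j)  ≡⟨ cong (λ ℓ → _ + prefix#D v (ℓ ∸ j)) eqL ⟩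
  prefix#D (reverse v) j + prefix#D v i               ≤⟨ +-monoʳ-≤ _ (v≤w i) ⟩
  prefix#D (reverse v) j + prefix#D w i               ∎)
  where
  open ≤-Reasoning
  i = length w ∸ j

≤ᴰ⇔reverse-≥ᴰ : ∀ {v w} → length v ≡ length w → #D v ≡ #D w → (v ≤ᴰ w) ⇔ (reverse w ≤ᴰ reverse v)
≤ᴰ⇔reverse-≥ᴰ {v} {w} eqL eqD =
  mk⇔ (≤ᴰ-reverse eqL eqD)
      (subst₂ _≤ᴰ_ (reverse-involutive v) (reverse-involutive w) ∘ ≤ᴰ-reverse eqL′ eqD′)
  where
  eqL′ : length (reverse w) ≡ length (reverse v)
  eqL′ = trans (length-reverse w) (trans (sym eqL) (sym (length-reverse v)))
  eqD′ : #D (reverse w) ≡ #D (reverse v)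
  eqD′ = trans (#D-reverse w) (trans (sym eqD) (sym (#D-reverse v)))

≤ᴰ-resp-≗ : ∀ {v v′ w w′} → (∀ t → prefix#D v t ≡ prefix#D v′ t) →
            (∀ t → prefix#D w t ≡ prefix#D w′ t) → (v ≤ᴰ w) ⇔ (v′ ≤ᴰ w′)
≤ᴰ-resp-≗ v≗v′ w≗w′ = mk⇔ (λ v≤w t → subst₂ _≤_ (v≗v′ t) (w≗w′ t) (v≤w t))
                          (λ v′≤w′ t → subst₂ _≤_ (sym (v≗v′ t)) (sym (w≗w′ t)) (v′≤w′ t))

-- decode n λs read backwards, with a single trailing U instead of n+1-k of them
blocksU : List ℕ → Word
blocksU = concatMap (λ b → replicate b D ++ U ∷ [])

blocksU-cons : ∀ a as → blocksU (a ∷ as) ≡ replicate a D ++ U ∷ blocksU as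
blocksU-cons a as = ++-assoc (replicate a D) (U ∷ []) (blocksU as)

reverse-blocks-reverse-++-U : ∀ λs → 1 ≤ length λs →
                              reverse (blocks (reverse λs)) ++ U ∷ [] ≡ blocksU λs
reverse-blocks-reverse-++-U λs nonempty = begin
  reverse (blocks (reverse λs)) ++ U ∷ []           ≡⟨ unfold-reverse U (blocks (reverse λs)) ⟨
  reverse (U ∷ blocks (reverse λs))                 ≡⟨ cong reverse (U∷blocks (reverse λs) nonempty′) ⟩
  reverse (concatMap upD (reverse λs))              ≡⟨ reverse-concatMap upD (reverse λs) ⟩
  concatMap (reverse ∘ upD) (reverse (reverse λs))  ≡⟨ cong (concatMap _) (reverse-involutive λs) ⟩
  concatMap (reverse ∘ upD) λs                      ≡⟨ concatMap-cong reverse-upD λs ⟩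
  blocksU λs                                        ∎
  where
  open ≡-Reasoning
  upD : ℕ → Word
  upD b = U ∷ replicate b D
  U∷blocks : ∀ xs → 1 ≤ length xs → U ∷ blocks xs ≡ concatMap upD xs
  U∷blocks (x ∷ xs) _ = refl
  nonempty′ : 1 ≤ length (reverse λs)
  nonempty′ = subst (1 ≤_) (sym (length-reverse λs)) nonempty
  reverse-upD : ∀ b → reverse (upD b) ≡ replicate b D ++ U ∷ []
  reverse-upD b = trans (unfold-reverse U (replicate b D))
                        (cong (_++ U ∷ []) (reverse-replicate b D))

prefix#D-reverse-decode : ∀ n λs → 1 ≤ length λs →
                          ∀ t → prefix#D (reverse (decode n λs)) t ≡ prefix#D (blocksU λs) t
prefix#D-reverse-decode n λs nonempty t = begin
  prefix#D (reverse (replicate c U ++ R)) t      ≡⟨ cong (λ w → prefix#D w t) (reverse-++ (replicate c U) R) ⟩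
  prefix#D (reverse R ++ reverse (replicate c U)) t
    ≡⟨ prefix#D-++-#D≡0 (reverse R) (trans (#D-reverse (replicate c U)) (#D-replicate-U c)) t ⟩
  prefix#D (reverse R) t                         ≡⟨ prefix#D-++-#D≡0 (reverse R) refl t ⟨
  prefix#D (reverse R ++ U ∷ []) t               ≡⟨ cong (λ w → prefix#D w t)
                                                         (reverse-blocks-reverse-++-U λs nonempty) ⟩
  prefix#D (blocksU λs) t                        ∎
  where
  open ≡-Reasoning
  c = suc n ∸ length λs
  R = blocks (reverse λs)

psum : ℕ → List ℕ → ℕ
psum m λs = sum (take m λs)

data Position (a : ℕ) : ℕ → Set where
  within : ∀ {t} → t ≤ a → Position a t
  beyond : ∀ t → Position a (a + suc t)

position : ∀ a t → Position a t
position zero    zero    = within z≤n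
position zero    (suc t) = beyond t
position (suc a) zero    = within z≤n
position (suc a) (suc t) with position a t
... | within t≤a = within (s≤s t≤a)
... | beyond t′  = beyond t′

prefix#D-blocksU-within : ∀ {t} a as → t ≤ a → prefix#D (blocksU (a ∷ as)) t ≡ t
prefix#D-blocksU-within a as t≤a rewrite blocksU-cons a as = prefix#D-replicate-D-++ a _ t≤a

prefix#D-blocksU-beyond : ∀ a as t →
                          prefix#D (blocksU (a ∷ as)) (a + suc t) ≡ a + prefix#D (blocksU as) t
prefix#D-blocksU-beyond a as t
  rewrite blocksU-cons a as | take-replicate-++ a (suc t) D (U ∷ blocksU as)
        | #D-++ (replicate a D) (U ∷ take t (blocksU as)) | #D-replicate-D a = refl

+∸+-shift : ∀ a s t m → (a + s) + ((a + suc t) ∸ ((a + s) + suc m)) ≡ a + (s + (t ∸ (s + m)))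
+∸+-shift a s t m
  rewrite +-assoc a s (suc m) | [m+n]∸[m+o]≡n∸o a (suc t) (s + suc m) | +-suc s m =
  +-assoc a s (t ∸ (s + m))

-- psum m λs D's precede the m-th U, which sits at position psum m λs + m.
prefix#D-blocksU-≤ : ∀ λs m t → prefix#D (blocksU λs) t ≤ psum m λs + (t ∸ (psum m λs + m))
prefix#D-blocksU-≤ []       m       t rewrite take-[] {A = Step} t = z≤n
prefix#D-blocksU-≤ (a ∷ as) zero    t = prefix#D-≤ (blocksU (a ∷ as)) t
prefix#D-blocksU-≤ (a ∷ as) (suc m) t with position a t
... | within t≤a rewrite prefix#D-blocksU-within a as t≤a =
  ≤-trans t≤a (≤-trans (m≤m+n a (psum m as)) (m≤m+n (a + psum m as) _))
... | beyond t′ rewrite prefix#D-blocksU-beyond a as t′ | +∸+-shift a (psum m as) t′ m =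
  +-monoʳ-≤ a (prefix#D-blocksU-≤ as m t′)

prefix#D-blocksU-attains : ∀ λs t →
                           ∃[ m ] psum m λs + (t ∸ (psum m λs + m)) ≤ prefix#D (blocksU λs) t
prefix#D-blocksU-attains []       t = t , bound≤
  where
  bound≤ : psum t [] + (t ∸ (psum t [] + t)) ≤ prefix#D [] t
  bound≤ rewrite take-[] {A = ℕ} t | take-[] {A = Step} t | n∸n≡0 t = z≤n
prefix#D-blocksU-attains (a ∷ as) t with position a t
... | within t≤a rewrite prefix#D-blocksU-within a as t≤a = zero , ≤-refl
... | beyond t′ with prefix#D-blocksU-attains as t′
...   | m , bound≤ = suc m , (begin
  psum (suc m) (a ∷ as) + ((a + suc t′) ∸ (psum (suc m) (a ∷ as) + suc m))
    ≡⟨ +∸+-shift a (psum m as) t′ m ⟩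
  a + (psum m as + (t′ ∸ (psum m as + m)))
    ≤⟨ +-monoʳ-≤ a bound≤ ⟩
  a + prefix#D (blocksU as) t′
    ≡⟨ prefix#D-blocksU-beyond a as t′ ⟨
  prefix#D (blocksU (a ∷ as)) (a + suc t′)
    ∎)
  where open ≤-Reasoning

prefix#D-blocksU-blockEnd : ∀ λs m → prefix#D (blocksU λs) (psum (suc m) λs + m) ≡ psum (suc m) λs
prefix#D-blocksU-blockEnd []       m rewrite take-[] {A = Step} m = refl
prefix#D-blocksU-blockEnd (a ∷ as) zero rewrite +-identityʳ a | +-identityʳ a =
  prefix#D-blocksU-within a as ≤-refl
prefix#D-blocksU-blockEnd (a ∷ as) (suc m)
  rewrite +-assoc a (psum (suc m) as) (suc m) | +-suc (psum (suc m) as) m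
        | prefix#D-blocksU-beyond a as (psum (suc m) as + m) =
  cong (a +_) (prefix#D-blocksU-blockEnd as m)

m+[n∸m]≡m⊔n : ∀ m n → m + (n ∸ m) ≡ m ⊔ n
m+[n∸m]≡m⊔n zero    n       = refl
m+[n∸m]≡m⊔n (suc m) zero    = cong suc (+-identityʳ m)
m+[n∸m]≡m⊔n (suc m) (suc n) = cong suc (m+[n∸m]≡m⊔n m n)

+∸+≡⊔ : ∀ x t m → x + (t ∸ (x + m)) ≡ x ⊔ (t ∸ m)
+∸+≡⊔ x t m = begin
  x + (t ∸ (x + m))  ≡⟨ cong (λ k → x + (t ∸ k)) (+-comm x m) ⟩
  x + (t ∸ (m + x))  ≡⟨ cong (x +_) (∸-+-assoc t m x) ⟨
  x + (t ∸ m ∸ x)    ≡⟨ m+[n∸m]≡m⊔n x (t ∸ m) ⟩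
  x ⊔ (t ∸ m)        ∎
  where open ≡-Reasoning

≤⊔pred⇒≤ : ∀ {r s} → s ≤ r ⊔ pred s → s ≤ r
≤⊔pred⇒≤ {r} {zero}  _ = z≤n
≤⊔pred⇒≤ {r} {suc s} s≤ with ⊔-sel r s
... | inj₁ r⊔s≡r = subst (suc s ≤_) r⊔s≡r s≤
... | inj₂ r⊔s≡s = ⊥-elim (1+n≰n (subst (suc s ≤_) r⊔s≡s s≤))

blocksU-≤ᴰ⇔⊴ : ∀ λs μs → (blocksU λs ≤ᴰ blocksU μs) ⇔ (λs ⊴ μs)
blocksU-≤ᴰ⇔⊴ λs μs = mk⇔ dominated pointwise
  where
  open ≤-Reasoning

  dominated : blocksU λs ≤ᴰ blocksU μs → λs ⊴ μs
  dominated _   zero    ()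
  dominated λ≤μ (suc m) _ = ≤⊔pred⇒≤ (begin
    s                              ≡⟨ prefix#D-blocksU-blockEnd λs m ⟨
    prefix#D (blocksU λs) (s + m)  ≤⟨ λ≤μ (s + m) ⟩
    prefix#D (blocksU μs) (s + m)  ≤⟨ prefix#D-blocksU-≤ μs (suc m) (s + m) ⟩
    r + ((s + m) ∸ (r + suc m))    ≡⟨ +∸+≡⊔ r (s + m) (suc m) ⟩
    r ⊔ ((s + m) ∸ suc m)          ≡⟨ cong (r ⊔_) (pred[m∸n]≡m∸[1+n] (s + m) m) ⟨
    r ⊔ pred ((s + m) ∸ m)         ≡⟨ cong (λ k → r ⊔ pred k) (m+n∸n≡m s m) ⟩
    r ⊔ pred s                     ∎)
    where
    s = psum (suc m) λs
    r = psum (suc m) μs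

  pointwise : λs ⊴ μs → blocksU λs ≤ᴰ blocksU μs
  pointwise λ⊴μ t with prefix#D-blocksU-attains μs t
  ... | m , attained = begin
    prefix#D (blocksU λs) t            ≤⟨ prefix#D-blocksU-≤ λs m t ⟩
    psum m λs + (t ∸ (psum m λs + m))  ≡⟨ +∸+≡⊔ (psum m λs) t m ⟩
    psum m λs ⊔ (t ∸ m)                ≤⟨ ⊔-monoˡ-≤ (t ∸ m) (psum≤ m) ⟩
    psum m μs ⊔ (t ∸ m)                ≡⟨ +∸+≡⊔ (psum m μs) t m ⟨
    psum m μs + (t ∸ (psum m μs + m))  ≤⟨ attained ⟩
    prefix#D (blocksU μs) t            ∎
    where
    psum≤ : ∀ m → psum m λs ≤ psum m μs
    psum≤ zero    = z≤n
    psum≤ (suc m) = λ⊴μ (suc m) (s≤s z≤n)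

proposition5p2 : (p : Param) (n : ℕ) → 1 ≤ n → (P Q : Word) → InF p n P → InF p n Q →
    (λs μs : List ℕ) → IsLambda p n P λs → IsLambda p n Q μs →
    ((P ≤S Q → λs ⊴ μs) × (λs ⊴ μs → P ≤S Q))
proposition5p2 p n _ P Q ((lengthP , _ , heightP) , _) ((lengthQ , _ , heightQ) , _) λs μs
               (nonemptyλ , _ , refl) (nonemptyμ , _ , refl) =
  Equivalence.to dominance , Equivalence.from dominance
  where
  open EquationalReasoning
  sameLength : length Q ≡ length P
  sameLength = trans lengthQ (sym lengthP)
  sameDownSteps : #D Q ≡ #D P
  sameDownSteps = #D-cong {Q} {P} sameLength (trans heightQ (sym heightP))
  dominance : (P ≤S Q) ⇔ (λs ⊴ μs)
  dominance = begin
    P ≤S Q                    ∼⟨ ≤S⇔≥ᴰ (sym sameLength) ⟩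
    Q ≤ᴰ P                    ∼⟨ ≤ᴰ⇔reverse-≥ᴰ sameLength sameDownSteps ⟩
    reverse P ≤ᴰ reverse Q    ∼⟨ ≤ᴰ-resp-≗ (prefix#D-reverse-decode n λs nonemptyλ)
                                           (prefix#D-reverse-decode n μs nonemptyμ) ⟩
    blocksU λs ≤ᴰ blocksU μs  ∼⟨ blocksU-≤ᴰ⇔⊴ λs μs ⟩
    λs ⊴ μs                   ∎
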